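{- Let $p$ be a prime, let $q$ be a power of $p$, let $k\ge 0$ be an integer, and let $a$ be a positive integer divisible by $p^{k}$. Then \[ 1+(q-1)\sum_{\substack{b\in\mathbb{Z}\\ 0\le b(q-1)<a}} \binom{a}{ b(q-1)}\equiv 0\pmod{p^{k+1}}. \] -}

module Defs where

open import Data.Nat using (ℕ; _*_; _∸_; _<?_)
open import Data.Nat.Combinatorics using (_C_)
open import Data.List using (upTo; map)
open import Data.Nat.ListAction using (sum)
open import Relation.Nullary.Decidable using (does)
open import Data.Bool using (if_then_else_)

-- S q a = Σ_{b ∈ ℤ, 0 ≤ b(q-1) < a} C(a, b(q-1)).
-- For q ≥ 2 we have q-1 ≥ 1, so b(q-1) < a forces 0 ≤ b < a; hence it
-- suffices to range over b ∈ {0, …, a-1} and keep those with b(q-1) < a.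
binomSum : ℕ → ℕ → ℕ
binomSum q a =
  sum (map (λ b → if does (b * (q ∸ 1) <? a) then a C (b * (q ∸ 1)) else 0) (upTo a))

{-# OPTIONS --safe #-}
-- Put m = q − 1 and A = (1 − t)((1 − t)^m − t^m)/(1 − t^m) ∈ ℤ[[t]]. Over the m-th roots of unity ζ,
-- A = (1 − t) ∏_ζ (1 − (1 + ζ) t)/(1 − ζ t), so the logarithmic derivative W = t A′/A has, for n ≥ 1,
-- W_n = −1 − Σ_ζ (1 + ζ)^n + Σ_ζ ζ^n = −(1 + m S_n) with S_n the binomial sum of the statement. The same
-- identity follows, without roots of unity, from Pascal's rule for the residue-class sums Σ_b C(n, b m + r).
-- Since q is a power of p, (1 − t)^q ≡ 1 − t^q and hence A ≡ 1 modulo p. Such an A factors as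
-- ∏_d (1 − x_d t^d) with p ∣ x_d, and the factor for d changes W_n by −d x_d^(n/d) when d ∣ n; if p^k ∣ n,
-- this is divisible by p^(k+1) because v_p(d) + n/d ≥ v_p(n) + 1.
module Submission where

open import Defs using (binomSum)
open import Data.Bool using (if_then_else_)
open import Data.Empty using (⊥-elim)
open import Data.Product using (_,_; _×_)
open import Data.Sum using (_⊎_; inj₁; inj₂)
open import Function using (_∘_; id)
open import Relation.Binary.PropositionalEquality
  using (_≡_; _≢_; refl; sym; trans; cong; cong₂; subst; module ≡-Reasoning)
open import Relation.Binary.Definitions using (Tri; tri<; tri≈; tri>)
open import Relation.Nullary using (¬_; Dec; yes; no; does)
open import Relation.Nullary.Decidable using (dec-true; dec-false)

module Arithmetic where
  open import Data.Nat
  open import Data.Nat.Properties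
  open import Data.Nat.Divisibility
  open import Data.Nat.Primality using (Prime; euclidsLemma; prime⇒nonZero; prime⇒nonTrivial)
  open import Data.Nat.Combinatorics using (_C_; nCk+nC[k+1]≡[n+1]C[k+1]; nC1≡n; nCn≡1)
  open import Data.Nat.Combinatorics.Specification using (k>n⇒nCk≡0)
  open import Data.Nat.Tactic.RingSolver using (solve-∀)
  open import Data.List using (map; applyUpTo)
  open import Data.Nat.ListAction using (sum)
  open ≡-Reasoning

  if-yes : ∀ {P A : Set} (P? : Dec P) {x y : A} → P → (if does P? then x else y) ≡ x
  if-yes P? {x} {y} p = cong (if_then x else y) (dec-true P? p)

  if-no : ∀ {P A : Set} (P? : Dec P) {x y : A} → ¬ P → (if does P? then x else y) ≡ y
  if-no P? {x} {y} ¬p = cong (if_then x else y) (dec-false P? ¬p)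

  indicator : {P : Set} → Dec P → ℕ
  indicator P? = if does P? then 1 else 0

  ∑< : ℕ → (ℕ → ℕ) → ℕ
  ∑< zero    f = 0
  ∑< (suc n) f = ∑< n f + f n

  syntax ∑< n (λ i → e) = ∑[ i < n ] e

  ∑<-cong : ∀ n {f g : ℕ → ℕ} → (∀ i → i < n → f i ≡ g i) → ∑< n f ≡ ∑< n g
  ∑<-cong zero    f≡g = refl
  ∑<-cong (suc n) f≡g = cong₂ _+_ (∑<-cong n λ i i<n → f≡g i (m<n⇒m<1+n i<n)) (f≡g n (n<1+n n))

  ∑<-zero : ∀ n {f : ℕ → ℕ} → (∀ i → i < n → f i ≡ 0) → ∑< n f ≡ 0
  ∑<-zero zero    f≡0 = refl
  ∑<-zero (suc n) f≡0 = cong₂ _+_ (∑<-zero n λ i i<n → f≡0 i (m<n⇒m<1+n i<n)) (f≡0 n (n<1+n n))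

  ∑<-distrib-+ : ∀ n (f g : ℕ → ℕ) → ∑[ i < n ] (f i + g i) ≡ ∑< n f + ∑< n g
  ∑<-distrib-+ zero    f g = refl
  ∑<-distrib-+ (suc n) f g = begin
    ∑[ i < n ] (f i + g i) + (f n + g n) ≡⟨ cong (_+ (f n + g n)) (∑<-distrib-+ n f g) ⟩
    ∑< n f + ∑< n g + (f n + g n)        ≡⟨ +-+-interchange (∑< n f) (∑< n g) (f n) (g n) ⟩
    ∑< n f + f n + (∑< n g + g n)        ∎
    where
    +-+-interchange : ∀ a b c d → a + b + (c + d) ≡ a + c + (b + d)
    +-+-interchange = solve-∀

  ∑<-suc : ∀ n (f : ℕ → ℕ) → ∑< (suc n) f ≡ f 0 + ∑[ i < n ] f (suc i)
  ∑<-suc zero    f = +-comm 0 (f 0)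
  ∑<-suc (suc n) f = trans (cong (_+ f (suc n)) (∑<-suc n f)) (+-assoc (f 0) _ _)

  sum-applyUpTo : ∀ n (f g : ℕ → ℕ) → sum (map f (applyUpTo g n)) ≡ ∑[ i < n ] f (g i)
  sum-applyUpTo zero    f g = refl
  sum-applyUpTo (suc n) f g = begin
    f (g 0) + sum (map f (applyUpTo (g ∘ suc) n)) ≡⟨ cong (f (g 0) +_) (sum-applyUpTo n f (g ∘ suc)) ⟩
    f (g 0) + ∑[ i < n ] f (g (suc i))            ≡⟨ ∑<-suc n (f ∘ g) ⟨
    ∑[ i < suc n ] f (g i)                        ∎

  ∑<-δ : ∀ N {c} → c < N → ∑[ b < N ] indicator (b ≟ c) ≡ 1
  ∑<-δ (suc N) {c} c<1+N with c ≟ N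
  ... | yes refl = cong₂ _+_ (∑<-zero c λ b b<c → if-no (b ≟ c) (<⇒≢ b<c)) (if-yes (c ≟ c) refl)
  ... | no  c≢N  = begin
    ∑[ b < N ] indicator (b ≟ c) + indicator (N ≟ c)
      ≡⟨ cong₂ _+_ (∑<-δ N (≤∧≢⇒< (≤-pred c<1+N) c≢N)) (if-no (N ≟ c) (c≢N ∘ sym)) ⟩
    1 + 0 ∎

  [k+1]*[n+1]C[k+1]≡[n+1]*nCk : ∀ n k → suc k * (suc n C suc k) ≡ suc n * (n C k)
  [k+1]*[n+1]C[k+1]≡[n+1]*nCk zero    zero    = refl
  [k+1]*[n+1]C[k+1]≡[n+1]*nCk zero    (suc k) =
    trans (cong (suc (suc k) *_) (k>n⇒nCk≡0 {1} {suc (suc k)} (s≤s (s≤s z≤n)))) (*-zeroʳ (suc (suc k)))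
  [k+1]*[n+1]C[k+1]≡[n+1]*nCk (suc n) zero    =
    trans (*-identityˡ (suc (suc n) C 1)) (trans (nC1≡n (suc (suc n))) (sym (*-identityʳ _)))
  [k+1]*[n+1]C[k+1]≡[n+1]*nCk (suc n) (suc k) = begin
    suc (suc k) * (suc (suc n) C suc (suc k))
      ≡⟨ cong (suc (suc k) *_) (nCk+nC[k+1]≡[n+1]C[k+1] (suc n) (suc k)) ⟨
    suc (suc k) * (suc n C suc k + suc n C suc (suc k))
      ≡⟨ regroup (suc k) (suc n C suc k) (suc n C suc (suc k)) ⟩
    suc n C suc k + (suc k * (suc n C suc k) + suc (suc k) * (suc n C suc (suc k)))
      ≡⟨ cong₂ (λ u v → suc n C suc k + (u + v)) ([k+1]*[n+1]C[k+1]≡[n+1]*nCk n k)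
                                                 ([k+1]*[n+1]C[k+1]≡[n+1]*nCk n (suc k)) ⟩
    suc n C suc k + (suc n * (n C k) + suc n * (n C suc k))
      ≡⟨ cong (suc n C suc k +_) (*-distribˡ-+ (suc n) (n C k) (n C suc k)) ⟨
    suc n C suc k + suc n * (n C k + n C suc k)
      ≡⟨ cong (λ u → suc n C suc k + suc n * u) (nCk+nC[k+1]≡[n+1]C[k+1] n k) ⟩
    suc (suc n) * (suc n C suc k) ∎
    where
    regroup : ∀ k a b → suc k * (a + b) ≡ a + (k * a + suc k * b)
    regroup = solve-∀

  private
    x*[y*z]≡y*[x*z] : ∀ x y z → x * (y * z) ≡ y * (x * z)
    x*[y*z]≡y*[x*z] = solve-∀

    x*y*z≡y*[x*z] : ∀ x y z → x * y * z ≡ y * (x * z)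
    x*y*z≡y*[x*z] = solve-∀

    x*[y*z]≡y*x*z : ∀ x y z → x * (y * z) ≡ y * x * z
    x*[y*z]≡y*x*z = solve-∀

    x*[y*z]≡z*[x*y] : ∀ x y z → x * (y * z) ≡ z * (x * y)
    x*[y*z]≡z*[x*y] = solve-∀

  m^a∣m^b : ∀ m {a b} → a ≤ b → m ^ a ∣ m ^ b
  m^a∣m^b m {a} a≤b with m≤n⇒∃[o]m+o≡n a≤b
  ... | o , refl = divides (m ^ o) (trans (^-distribˡ-+-* m a o) (*-comm (m ^ a) (m ^ o)))

  n∣k*nCk : ∀ n k → n ∣ k * (n C k)
  n∣k*nCk zero    zero    = divides 0 refl
  n∣k*nCk zero    (suc k) = divides 0 (*-zeroʳ (suc k))
  n∣k*nCk (suc n) zero    = divides 0 refl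
  n∣k*nCk (suc n) (suc k) =
    divides (n C k) (trans ([k+1]*[n+1]C[k+1]≡[n+1]*nCk n k) (*-comm (suc n) (n C k)))

  module _ {p : ℕ} (p-prime : Prime p) where
    private
      instance
        p≢0 : NonZero p
        p≢0 = prime⇒nonZero p-prime
      p>1 : 1 < p
      p>1 = nonTrivial⇒n>1 p {{prime⇒nonTrivial p-prime}}

    pᵉ∣a*b∧p∤b⇒pᵉ∣a : ∀ e {a b} → p ^ e ∣ a * b → ¬ p ∣ b → p ^ e ∣ a
    pᵉ∣a*b∧p∤b⇒pᵉ∣a zero    _     _   = 1∣ _
    pᵉ∣a*b∧p∤b⇒pᵉ∣a (suc e) {a} {b} pᵉ⁺¹∣ab p∤b
      with euclidsLemma a b p-prime (∣-trans (m∣m*n (p ^ e)) pᵉ⁺¹∣ab)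
    ... | inj₂ p∣b = ⊥-elim (p∤b p∣b)
    ... | inj₁ (divides a′ refl) =
      subst (p * p ^ e ∣_) (*-comm p a′) (*-monoʳ-∣ p (pᵉ∣a*b∧p∤b⇒pᵉ∣a e pᵉ∣a′b p∤b))
      where
      pᵉ∣a′b : p ^ e ∣ a′ * b
      pᵉ∣a′b = *-cancelˡ-∣ p (subst (p * p ^ e ∣_) (x*y*z≡y*[x*z] a′ p b) pᵉ⁺¹∣ab)

    p∣pᵉCi : ∀ e {i} → 0 < i → i < p ^ e → p ∣ (p ^ e) C i
    p∣pᵉCi e {i@(suc _)} _ i<pᵉ with p ∣? (p ^ e) C i
    ... | yes p∣C = p∣C
    ... | no  p∤C = ⊥-elim (<⇒≱ i<pᵉ (∣⇒≤ (pᵉ∣a*b∧p∤b⇒pᵉ∣a e (n∣k*nCk (p ^ e) i) p∤C)))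

    2≤p^[1+e] : ∀ e → 2 ≤ p ^ suc e
    2≤p^[1+e] e = ≤-trans p>1 (m≤m*n p (p ^ e) {{m^n≢0 p e}})

    pᵏ∣c*d⇒p¹⁺ᵏ∣d*pᶜ : ∀ k {c d} → .{{NonZero c}} → p ^ k ∣ c * d → p ^ suc k ∣ d * p ^ c
    pᵏ∣c*d⇒p¹⁺ᵏ∣d*pᶜ zero {suc c} {d} _ = ∣n⇒∣m*n d (*-monoʳ-∣ p (1∣ (p ^ c)))
    pᵏ∣c*d⇒p¹⁺ᵏ∣d*pᶜ (suc k) {c} {d} pᵏ⁺¹∣cd
      with euclidsLemma c d p-prime (∣-trans (m∣m*n (p ^ k)) pᵏ⁺¹∣cd)
    ... | inj₁ (divides c′ refl) = ∣-trans (subst (p ^ suc (suc k) ∣_) (x*[y*z]≡y*[x*z] p d _) (*-monoʳ-∣ p IH))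
                                           (*-monoʳ-∣ d (m^a∣m^b p (m<m*n c′ p p>1)))
      where
      instance
        c′≢0 : NonZero c′
        c′≢0 = m*n≢0⇒m≢0 c′
      IH : p ^ suc k ∣ d * p ^ c′
      IH = pᵏ∣c*d⇒p¹⁺ᵏ∣d*pᶜ k {c′} (*-cancelˡ-∣ p (subst (p ^ suc k ∣_) (x*y*z≡y*[x*z] c′ p d) pᵏ⁺¹∣cd))
    ... | inj₂ (divides d′ refl) = subst (p ^ suc (suc k) ∣_) (x*[y*z]≡y*x*z p d′ (p ^ c)) (*-monoʳ-∣ p IH)
      where
      IH : p ^ suc k ∣ d′ * p ^ c
      IH = pᵏ∣c*d⇒p¹⁺ᵏ∣d*pᶜ k {c} {d′} (*-cancelˡ-∣ p (subst (p ^ suc k ∣_) (x*[y*z]≡z*[x*y] c d′ p) pᵏ⁺¹∣cd))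

  prime∣m^[1+n]⇒prime∣m : ∀ {r m} → Prime r → ∀ n → r ∣ m ^ suc n → r ∣ m
  prime∣m^[1+n]⇒prime∣m {m = m} _ zero r∣m¹ = subst (_ ∣_) (*-identityʳ m) r∣m¹
  prime∣m^[1+n]⇒prime∣m {m = m} r-prime (suc n) r∣mⁿ⁺² with euclidsLemma m (m ^ suc n) r-prime r∣mⁿ⁺²
  ... | inj₁ r∣m     = r∣m
  ... | inj₂ r∣mⁿ⁺¹ = prime∣m^[1+n]⇒prime∣m r-prime n r∣mⁿ⁺¹

  module ResidueSums (m : ℕ) .{{_ : NonZero m}} where

    residueSum : ℕ → ℕ → ℕ
    residueSum r n = ∑[ b < suc n ] (n C (b * m + r))

    private
      residueSum-extend : ∀ r n → ∑[ b < suc (suc n) ] (n C (b * m + r)) ≡ residueSum r n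
      residueSum-extend r n = begin
        residueSum r n + n C (suc n * m + r) ≡⟨ cong (residueSum r n +_) (k>n⇒nCk≡0 n<[1+n]m+r) ⟩
        residueSum r n + 0                   ≡⟨ +-identityʳ _ ⟩
        residueSum r n                       ∎
        where
        n<[1+n]m+r : n < suc n * m + r
        n<[1+n]m+r = <-≤-trans (n<1+n n) (≤-trans (m≤m*n (suc n) m) (m≤m+n _ r))

    residueSum-pascal : ∀ r n → residueSum (suc r) (suc n) ≡ residueSum (suc r) n + residueSum r n
    residueSum-pascal r n = begin
      ∑[ b < suc (suc n) ] (suc n C (b * m + suc r))
        ≡⟨ ∑<-cong (suc (suc n)) (λ b _ → pascal b) ⟩
      ∑[ b < suc (suc n) ] (n C (b * m + r) + n C (b * m + suc r))
        ≡⟨ ∑<-distrib-+ (suc (suc n)) _ _ ⟩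
      ∑[ b < suc (suc n) ] (n C (b * m + r)) + ∑[ b < suc (suc n) ] (n C (b * m + suc r))
        ≡⟨ cong₂ _+_ (residueSum-extend r n) (residueSum-extend (suc r) n) ⟩
      residueSum r n + residueSum (suc r) n
        ≡⟨ +-comm (residueSum r n) _ ⟩
      residueSum (suc r) n + residueSum r n ∎
      where
      pascal : ∀ b → suc n C (b * m + suc r) ≡ n C (b * m + r) + n C (b * m + suc r)
      pascal b rewrite +-suc (b * m) r = sym (nCk+nC[k+1]≡[n+1]C[k+1] n (b * m + r))

    residueSum-zero : ∀ n → residueSum 0 n ≡ 1 + residueSum m n
    residueSum-zero n = begin
      residueSum 0 n
        ≡⟨ ∑<-suc n _ ⟩
      1 + ∑[ b < n ] (n C (suc b * m + 0))
        ≡⟨ cong (1 +_) (∑<-cong n λ b _ → cong (n C_) (trans (+-identityʳ _) (+-comm m (b * m)))) ⟩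
      1 + ∑[ b < n ] (n C (b * m + m))
        ≡⟨ cong (1 +_) (+-identityʳ _) ⟨
      1 + (∑[ b < n ] (n C (b * m + m)) + 0)
        ≡⟨ cong (λ top → 1 + (∑[ b < n ] (n C (b * m + m)) + top)) (k>n⇒nCk≡0 n<nm+m) ⟨
      1 + residueSum m n ∎
      where
      n<nm+m : n < n * m + m
      n<nm+m = ≤-<-trans (m≤m*n n m) (m<m+n (n * m) (>-nonZero⁻¹ m))

    private
      ∑<-multiples : ∀ n → ∑[ b < suc n ] indicator (b * m ≟ n) ≡ indicator (m ∣? n)
      ∑<-multiples n with m ∣? n
      ... | yes (divides c refl) =
        trans (∑<-cong (suc (c * m)) λ b _ → cancel b) (∑<-δ (suc (c * m)) (s≤s (m≤m*n c m)))
        where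
        cancel : ∀ b → indicator (b * m ≟ c * m) ≡ indicator (b ≟ c)
        cancel b with b ≟ c
        ... | yes refl = trans (if-yes (b * m ≟ b * m) refl) (sym (if-yes (b ≟ b) refl))
        ... | no  b≢c  = trans (if-no (b * m ≟ c * m) (b≢c ∘ *-cancelʳ-≡ b c m)) (sym (if-no (b ≟ c) b≢c))
      ... | no  m∤n = ∑<-zero (suc n) λ b _ → if-no (b * m ≟ n) (λ bm≡n → m∤n (divides b (sym bm≡n)))

      C-decompose : ∀ n b →
        n C (b * m + 0) ≡ (if does (b * m <? n) then n C (b * m) else 0) + indicator (b * m ≟ n)
      C-decompose n b rewrite +-identityʳ (b * m) with <-cmp (b * m) n
      ... | tri< bm<n bm≢n _ =
        sym (trans (cong₂ _+_ (if-yes (b * m <? n) bm<n) (if-no (b * m ≟ n) bm≢n)) (+-identityʳ _))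
      ... | tri≈ bm≮n refl _ =
        trans (nCn≡1 (b * m)) (sym (cong₂ _+_ (if-no (b * m <? b * m) bm≮n) (if-yes (b * m ≟ b * m) refl)))
      ... | tri> bm≮n bm≢n n<bm =
        trans (k>n⇒nCk≡0 n<bm) (sym (cong₂ _+_ (if-no (b * m <? n) bm≮n) (if-no (b * m ≟ n) bm≢n)))

    residueSum-binomSum : ∀ n → residueSum 0 n ≡ binomSum (suc m) n + indicator (m ∣? n)
    residueSum-binomSum n = begin
      residueSum 0 n
        ≡⟨ ∑<-cong (suc n) (λ b _ → C-decompose n b) ⟩
      ∑[ b < suc n ] (term b + indicator (b * m ≟ n))
        ≡⟨ ∑<-distrib-+ (suc n) term _ ⟩
      ∑< n term + term n + ∑[ b < suc n ] indicator (b * m ≟ n)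
        ≡⟨ cong₂ _+_ (trans (cong (∑< n term +_) term-n≡0) (+-identityʳ _)) (∑<-multiples n) ⟩
      ∑< n term + indicator (m ∣? n)
        ≡⟨ cong (_+ indicator (m ∣? n)) (sum-applyUpTo n term id) ⟨
      binomSum (suc m) n + indicator (m ∣? n) ∎
      where
      term : ℕ → ℕ
      term b = if does (b * m <? n) then n C (b * m) else 0
      term-n≡0 : term n ≡ 0
      term-n≡0 = if-no (n * m <? n) (≤⇒≯ (m≤m*n n m))

open Arithmetic

module PowerSeries where
  open import Data.Nat as ℕ using (ℕ; zero; suc; NonZero)
  import Data.Nat.Properties as ℕ
  import Data.Nat.Divisibility as ℕ
  import Data.Nat.DivMod as ℕ
  open import Data.Nat.Primality using (Prime)
  open import Data.Integer as ℤ using (ℤ; _+_; _-_; _*_; -_; 0ℤ; 1ℤ; _^_)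
  import Data.Integer.Properties as ℤ
  open import Data.Integer.Divisibility.Signed
    using (_∣_; divides; ∣-refl; ∣-trans; ∣m∣n⇒∣m+n; ∣m+n∣m⇒∣n; ∣m⇒∣-m; ∣m⇒∣m*n; *-monoˡ-∣; *-monoʳ-∣; ∣ᵤ⇒∣)
  open import Data.Integer.Tactic.RingSolver using (solve-∀)
  open import Data.Maybe using (Maybe; map)
  open import Level using (0ℓ)
  open import Algebra.Bundles using (CommutativeRing)
  open import Algebra.Solver.Ring.AlmostCommutativeRing using (fromCommutativeRing; _-Raw-AlmostCommutative⟶_)
  import Algebra.Solver.Ring
  import Relation.Binary.Reasoning.Setoid
  open import Relation.Nullary.Decidable using (dec⇒maybe)

  Series : Set
  Series = ℕ → ℤ

  infix  4 _≈_
  infixl 6 _⊕_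
  infixl 7 _⊛_
  infix  8 ⊝_

  _≈_ : Series → Series → Set
  A ≈ B = ∀ n → A n ≡ B n

  ≈-refl : ∀ {A} → A ≈ A
  ≈-refl _ = refl

  ≈-sym : ∀ {A B} → A ≈ B → B ≈ A
  ≈-sym A≈B n = sym (A≈B n)

  ≈-trans : ∀ {A B C} → A ≈ B → B ≈ C → A ≈ C
  ≈-trans A≈B B≈C n = trans (A≈B n) (B≈C n)

  _⊕_ : Series → Series → Series
  (A ⊕ B) n = A n + B n

  ⊝_ : Series → Series
  (⊝ A) n = - A n

  [_] : ℤ → Series
  [ c ] zero    = c
  [ c ] (suc _) = 0ℤ

  𝟘 : Series
  𝟘 _ = 0ℤ

  𝟙 : Series
  𝟙 = [ 1ℤ ]

  []-+ : ∀ a b → [ a + b ] ≈ [ a ] ⊕ [ b ]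
  []-+ a b zero    = refl
  []-+ a b (suc _) = refl

  ⊝-[] : ∀ c → ⊝ [ c ] ≈ [ - c ]
  ⊝-[] c zero    = refl
  ⊝-[] c (suc _) = refl

  𝟙-pos : ∀ {n} → 0 ℕ.< n → 𝟙 n ≡ 0ℤ
  𝟙-pos {suc n} _ = refl

  tail : Series → Series
  tail A n = A (suc n)

  _⊛_ : Series → Series → Series
  (A ⊛ B) zero    = A 0 * B 0
  (A ⊛ B) (suc n) = A 0 * B (suc n) + (tail A ⊛ B) n

  ⊕-cong : ∀ {A A′ B B′} → A ≈ A′ → B ≈ B′ → A ⊕ B ≈ A′ ⊕ B′
  ⊕-cong A≈A′ B≈B′ n = cong₂ _+_ (A≈A′ n) (B≈B′ n)

  ⊝-cong : ∀ {A A′} → A ≈ A′ → ⊝ A ≈ ⊝ A′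
  ⊝-cong A≈A′ n = cong -_ (A≈A′ n)

  ⊛-cong : ∀ {A A′ B B′} → A ≈ A′ → B ≈ B′ → A ⊛ B ≈ A′ ⊛ B′
  ⊛-cong A≈A′ B≈B′ zero    = cong₂ _*_ (A≈A′ 0) (B≈B′ 0)
  ⊛-cong A≈A′ B≈B′ (suc n) = cong₂ _+_ (cong₂ _*_ (A≈A′ 0) (B≈B′ (suc n))) (⊛-cong (A≈A′ ∘ suc) B≈B′ n)

  infixr 8 _∙_
  _∙_ : ℤ → Series → Series
  (c ∙ A) n = c * A n

  ⊕-congˡ : ∀ A {B B′} → B ≈ B′ → A ⊕ B ≈ A ⊕ B′
  ⊕-congˡ A = ⊕-cong (≈-refl {A})

  ⊕-congʳ : ∀ {A A′} B → A ≈ A′ → A ⊕ B ≈ A′ ⊕ B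
  ⊕-congʳ B A≈A′ = ⊕-cong A≈A′ (≈-refl {B})

  ⊛-congˡ : ∀ A {B B′} → B ≈ B′ → A ⊛ B ≈ A ⊛ B′
  ⊛-congˡ A = ⊛-cong (≈-refl {A})

  ⊛-congʳ : ∀ {A A′} B → A ≈ A′ → A ⊛ B ≈ A′ ⊛ B
  ⊛-congʳ B A≈A′ = ⊛-cong A≈A′ (≈-refl {B})

  []-⊛ : ∀ c B → [ c ] ⊛ B ≈ c ∙ B
  []-⊛ c B zero    = refl
  []-⊛ c B (suc n) = trans (cong (c * B (suc n) +_) (𝟘-⊛ n)) (ℤ.+-identityʳ _)
    where
    𝟘-⊛ : 𝟘 ⊛ B ≈ 𝟘
    𝟘-⊛ zero    = refl
    𝟘-⊛ (suc n) = cong (0ℤ +_) (𝟘-⊛ n)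

  ∙-⊛ : ∀ c A B → (c ∙ A) ⊛ B ≈ c ∙ (A ⊛ B)
  ∙-⊛ c A B zero    = ℤ.*-assoc c (A 0) (B 0)
  ∙-⊛ c A B (suc n) = begin
    c * A 0 * B (suc n) + (c ∙ tail A ⊛ B) n
      ≡⟨ cong₂ _+_ (ℤ.*-assoc c (A 0) (B (suc n))) (∙-⊛ c (tail A) B n) ⟩
    c * (A 0 * B (suc n)) + c * (tail A ⊛ B) n
      ≡⟨ ℤ.*-distribˡ-+ c _ _ ⟨
    c * (A 0 * B (suc n) + (tail A ⊛ B) n) ∎
    where open ≡-Reasoning

  ⊛-identityˡ : ∀ A → 𝟙 ⊛ A ≈ A
  ⊛-identityˡ A n = trans ([]-⊛ 1ℤ A n) (ℤ.*-identityˡ (A n))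

  ⊛-distribʳ-⊕ : ∀ A B C → (A ⊕ B) ⊛ C ≈ A ⊛ C ⊕ B ⊛ C
  ⊛-distribʳ-⊕ A B C zero    = ℤ.*-distribʳ-+ (C 0) (A 0) (B 0)
  ⊛-distribʳ-⊕ A B C (suc n) = begin
    (a + b) * c + ((tail A ⊕ tail B) ⊛ C) n
      ≡⟨ cong₂ _+_ (ℤ.*-distribʳ-+ c a b) (⊛-distribʳ-⊕ (tail A) (tail B) C n) ⟩
    (a * c + b * c) + ((tail A ⊛ C) n + (tail B ⊛ C) n)
      ≡⟨ interchange (a * c) (b * c) _ _ ⟩
    (a * c + (tail A ⊛ C) n) + (b * c + (tail B ⊛ C) n) ∎
    where
    open ≡-Reasoning
    a b c : ℤ
    a = A 0
    b = B 0
    c = C (suc n)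
    interchange : ∀ w x y z → (w + x) + (y + z) ≡ (w + y) + (x + z)
    interchange = solve-∀

  ⊛-comm : ∀ A B → A ⊛ B ≈ B ⊛ A
  ⊛-comm A B zero          = ℤ.*-comm (A 0) (B 0)
  ⊛-comm A B (suc zero)    = trans (ℤ.+-comm (A 0 * B 1) _) (cong₂ _+_ (ℤ.*-comm (A 1) (B 0)) (ℤ.*-comm (A 0) (B 1)))
  ⊛-comm A B (suc (suc n)) = begin
    a₀b + (tail A ⊛ B) (suc n)            ≡⟨ cong (a₀b +_) (⊛-comm (tail A) B (suc n)) ⟩
    a₀b + (b₀a + (tail B ⊛ tail A) n)     ≡⟨ cong (λ z → a₀b + (b₀a + z)) (⊛-comm (tail B) (tail A) n) ⟩
    a₀b + (b₀a + (tail A ⊛ tail B) n)     ≡⟨ swap a₀b b₀a _ ⟩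
    b₀a + (a₀b + (tail A ⊛ tail B) n)     ≡⟨ cong (b₀a +_) (⊛-comm A (tail B) (suc n)) ⟩
    b₀a + (tail B ⊛ A) (suc n)            ∎
    where
    open ≡-Reasoning
    a₀b b₀a : ℤ
    a₀b = A 0 * B (suc (suc n))
    b₀a = B 0 * A (suc (suc n))
    swap : ∀ x y z → x + (y + z) ≡ y + (x + z)
    swap = solve-∀

  ⊛-assoc : ∀ A B C → (A ⊛ B) ⊛ C ≈ A ⊛ (B ⊛ C)
  ⊛-assoc A B C zero    = ℤ.*-assoc (A 0) (B 0) (C 0)
  ⊛-assoc A B C (suc n) = begin
    a * b * c + ((a ∙ tail B ⊕ tail A ⊛ B) ⊛ C) n
      ≡⟨ cong (a * b * c +_) (⊛-distribʳ-⊕ (a ∙ tail B) (tail A ⊛ B) C n) ⟩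
    a * b * c + ((a ∙ tail B ⊛ C) n + ((tail A ⊛ B) ⊛ C) n)
      ≡⟨ cong₂ (λ u v → a * b * c + (u + v)) (∙-⊛ a (tail B) C n) (⊛-assoc (tail A) B C n) ⟩
    a * b * c + (a * (tail B ⊛ C) n + (tail A ⊛ (B ⊛ C)) n)
      ≡⟨ regroup a b c _ _ ⟩
    a * (b * c + (tail B ⊛ C) n) + (tail A ⊛ (B ⊛ C)) n ∎
    where
    open ≡-Reasoning
    a b c : ℤ
    a = A 0
    b = B 0
    c = C (suc n)
    regroup : ∀ a b c x y → a * b * c + (a * x + y) ≡ a * (b * c + x) + y
    regroup = solve-∀

  ⊛-distribˡ-⊕ : ∀ A B C → A ⊛ (B ⊕ C) ≈ A ⊛ B ⊕ A ⊛ C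
  ⊛-distribˡ-⊕ A B C = ≈-trans (⊛-comm A (B ⊕ C)) (≈-trans (⊛-distribʳ-⊕ B C A) (⊕-cong (⊛-comm B A) (⊛-comm C A)))

  seriesRing : CommutativeRing 0ℓ 0ℓ
  seriesRing = record
    { Carrier = Series ; _≈_ = _≈_ ; _+_ = _⊕_ ; _*_ = _⊛_ ; -_ = ⊝_ ; 0# = 𝟘 ; 1# = 𝟙
    ; isCommutativeRing = record
      { isRing = record
        { +-isAbelianGroup = record
          { isGroup = record
            { isMonoid = record
              { isSemigroup = record
                { isMagma = record
                  { isEquivalence = record { refl = ≈-refl ; sym = ≈-sym ; trans = ≈-trans }
                  ; ∙-cong = ⊕-cong }
                ; assoc = λ A B C n → ℤ.+-assoc (A n) (B n) (C n) }
              ; identity = (λ A n → ℤ.+-identityˡ (A n)) , (λ A n → ℤ.+-identityʳ (A n)) }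
            ; inverse = (λ A n → ℤ.+-inverseˡ (A n)) , (λ A n → ℤ.+-inverseʳ (A n))
            ; ⁻¹-cong = ⊝-cong }
          ; comm = λ A B n → ℤ.+-comm (A n) (B n) }
        ; *-cong = ⊛-cong
        ; *-assoc = ⊛-assoc
        ; *-identity = ⊛-identityˡ , (λ A → ≈-trans (⊛-comm A 𝟙) (⊛-identityˡ A))
        ; distrib = ⊛-distribˡ-⊕ , (λ A B C → ⊛-distribʳ-⊕ B C A) }
      ; *-comm = ⊛-comm } }

  []-morphism : ℤ.+-*-rawRing -Raw-AlmostCommutative⟶ fromCommutativeRing seriesRing
  []-morphism = record
    { ⟦_⟧    = [_]
    ; +-homo = []-+
    ; *-homo = λ { a b zero → refl ; a b (suc n) → sym (trans ([]-⊛ a [ b ] (suc n)) (ℤ.*-zeroʳ a)) }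
    ; -‿homo = λ a → ≈-sym (⊝-[] a)
    ; 0-homo = λ { zero → refl ; (suc n) → refl }
    ; 1-homo = ≈-refl }

  []-≟ : ∀ a b → Maybe ([ a ] ≈ [ b ])
  []-≟ a b = map (λ a≡b n → cong (λ c → [ c ] n) a≡b) (dec⇒maybe (a ℤ.≟ b))

  open Algebra.Solver.Ring ℤ.+-*-rawRing (fromCommutativeRing seriesRing) []-morphism []-≟
    using (solve; _:=_; _:+_; _:*_; :-_; con) public

  module ≈-Reasoning = Relation.Binary.Reasoning.Setoid (CommutativeRing.setoid seriesRing)

  shift : ℕ → Series → Series
  shift zero    A n       = A n
  shift (suc d) A zero    = 0ℤ
  shift (suc d) A (suc n) = shift d A n

  t^_ : ℕ → Series
  t^ d = shift d 𝟙

  shift-cong : ∀ d {A B} → A ≈ B → shift d A ≈ shift d B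
  shift-cong zero    A≈B n       = A≈B n
  shift-cong (suc d) A≈B zero    = refl
  shift-cong (suc d) A≈B (suc n) = shift-cong d A≈B n

  shift-+ : ∀ d A n → shift d A (d ℕ.+ n) ≡ A n
  shift-+ zero    A n = refl
  shift-+ (suc d) A n = shift-+ d A n

  shift-< : ∀ d A {n} → n ℕ.< d → shift d A n ≡ 0ℤ
  shift-< (suc d) A {zero}  _         = refl
  shift-< (suc d) A {suc n} (ℕ.s≤s n<d) = shift-< d A n<d

  shift-shift : ∀ a b A → shift a (shift b A) ≈ shift (a ℕ.+ b) A
  shift-shift zero    b A n       = refl
  shift-shift (suc a) b A zero    = refl
  shift-shift (suc a) b A (suc n) = shift-shift a b A n

  shift-⊛ : ∀ d A B → shift d A ⊛ B ≈ shift d (A ⊛ B)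
  shift-⊛ zero    A B n       = refl
  shift-⊛ (suc d) A B zero    = ℤ.*-zeroˡ (B 0)
  shift-⊛ (suc d) A B (suc n) =
    trans (cong (_+ (shift d A ⊛ B) n) (ℤ.*-zeroˡ (B (suc n)))) (trans (ℤ.+-identityˡ _) (shift-⊛ d A B n))

  t^-⊛ : ∀ d B → t^ d ⊛ B ≈ shift d B
  t^-⊛ d B = ≈-trans (shift-⊛ d 𝟙 B) (shift-cong d (⊛-identityˡ B))

  t^-+ : ∀ a b → t^ a ⊛ t^ b ≈ t^ (a ℕ.+ b)
  t^-+ a b = ≈-trans (t^-⊛ a (t^ b)) (shift-shift a b 𝟙)

  t^-≡ : ∀ d → (t^ d) d ≡ 1ℤ
  t^-≡ zero    = refl
  t^-≡ (suc d) = t^-≡ d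

  t^-≢ : ∀ d {n} → n ≢ d → (t^ d) n ≡ 0ℤ
  t^-≢ zero    {zero}  n≢d = ⊥-elim (n≢d refl)
  t^-≢ zero    {suc n} _   = refl
  t^-≢ (suc d) {zero}  _   = refl
  t^-≢ (suc d) {suc n} n≢d = t^-≢ d (n≢d ∘ cong suc)

  θ : Series → Series
  θ A n = ℤ.+ n * A n

  θ-cong : ∀ {A B} → A ≈ B → θ A ≈ θ B
  θ-cong A≈B n = cong (ℤ.+ n *_) (A≈B n)

  θ-⊕ : ∀ A B → θ (A ⊕ B) ≈ θ A ⊕ θ B
  θ-⊕ A B n = ℤ.*-distribˡ-+ (ℤ.+ n) (A n) (B n)

  θ-⊝ : ∀ A → θ (⊝ A) ≈ ⊝ θ A
  θ-⊝ A n = sym (ℤ.neg-distribʳ-* (ℤ.+ n) (A n))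

  θ-[] : ∀ c → θ [ c ] ≈ 𝟘
  θ-[] c zero    = refl
  θ-[] c (suc n) = ℤ.*-zeroʳ (ℤ.+ suc n)

  θ-t^ : ∀ d → θ (t^ d) ≈ [ ℤ.+ d ] ⊛ t^ d
  θ-t^ d n with n ℕ.≟ d
  ... | yes refl = sym ([]-⊛ (ℤ.+ n) (t^ n) n)
  ... | no  n≢d  = begin
    ℤ.+ n * (t^ d) n ≡⟨ cong (ℤ.+ n *_) (t^-≢ d n≢d) ⟩
    ℤ.+ n * 0ℤ       ≡⟨ ℤ.*-zeroʳ (ℤ.+ n) ⟩
    0ℤ               ≡⟨ ℤ.*-zeroʳ (ℤ.+ d) ⟨
    ℤ.+ d * 0ℤ       ≡⟨ cong (ℤ.+ d *_) (t^-≢ d n≢d) ⟨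
    ℤ.+ d * (t^ d) n ≡⟨ []-⊛ (ℤ.+ d) (t^ d) n ⟨
    ([ ℤ.+ d ] ⊛ t^ d) n ∎
    where open ≡-Reasoning

  θ-[]⊛ : ∀ c A → θ ([ c ] ⊛ A) ≈ [ c ] ⊛ θ A
  θ-[]⊛ c A n = begin
    ℤ.+ n * ([ c ] ⊛ A) n   ≡⟨ cong (ℤ.+ n *_) ([]-⊛ c A n) ⟩
    ℤ.+ n * (c * A n)       ≡⟨ swap (ℤ.+ n) c (A n) ⟩
    c * (ℤ.+ n * A n)       ≡⟨ []-⊛ c (θ A) n ⟨
    ([ c ] ⊛ θ A) n         ∎
    where
    open ≡-Reasoning
    swap : ∀ x y z → x * (y * z) ≡ y * (x * z)
    swap = solve-∀

  θ-⊛ : ∀ A B → θ (A ⊛ B) ≈ θ A ⊛ B ⊕ A ⊛ θ B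
  θ-⊛ A B zero    = leibniz₀ (A 0) (B 0)
    where
    leibniz₀ : ∀ a b → 0ℤ * (a * b) ≡ 0ℤ * a * b + a * (0ℤ * b)
    leibniz₀ = solve-∀
  θ-⊛ A B (suc n) = begin
    (1ℤ + x) * (a * b + c)
      ≡⟨ expand x a b c ⟩
    (1ℤ + x) * (a * b) + (c + x * c)
      ≡⟨ cong (λ z → (1ℤ + x) * (a * b) + (c + z)) (θ-⊛ (tail A) B n) ⟩
    (1ℤ + x) * (a * b) + (c + (u + v))
      ≡⟨ regroup x a b c u v ⟩
    (0ℤ * a * b + (u + c)) + (a * ((1ℤ + x) * b) + v)
      ≡⟨ cong (λ z → (0ℤ * a * b + z) + (a * ((1ℤ + x) * b) + v)) tail-θ⊛B ⟨
    (θ A ⊛ B ⊕ A ⊛ θ B) (suc n) ∎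
    where
    open ≡-Reasoning
    x a b c u v : ℤ
    x = ℤ.+ n
    a = A 0
    b = B (suc n)
    c = (tail A ⊛ B) n
    u = (θ (tail A) ⊛ B) n
    v = (tail A ⊛ θ B) n
    tail-θ : tail (θ A) ≈ θ (tail A) ⊕ tail A
    tail-θ i = trans (ℤ.suc-* (ℤ.+ i) (A (suc i))) (ℤ.+-comm (A (suc i)) _)
    tail-θ⊛B : (tail (θ A) ⊛ B) n ≡ u + c
    tail-θ⊛B = trans (⊛-congʳ B tail-θ n) (⊛-distribʳ-⊕ (θ (tail A)) (tail A) B n)
    expand : ∀ x a b c → (1ℤ + x) * (a * b + c) ≡ (1ℤ + x) * (a * b) + (c + x * c)
    expand = solve-∀
    regroup : ∀ x a b c u v → (1ℤ + x) * (a * b) + (c + (u + v)) ≡ (0ℤ * a * b + (u + c)) + (a * ((1ℤ + x) * b) + v)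
    regroup = solve-∀

  infixr 8 _⊛^_
  _⊛^_ : Series → ℕ → Series
  A ⊛^ zero  = 𝟙
  A ⊛^ suc j = A ⊛ A ⊛^ j

  θ-⊛^ : ∀ A j → θ (A ⊛^ suc j) ≈ [ ℤ.+ suc j ] ⊛ θ A ⊛ A ⊛^ j
  θ-⊛^ A zero    = begin
    θ (A ⊛ 𝟙)          ≈⟨ θ-cong (λ n → trans (⊛-comm A 𝟙 n) (⊛-identityˡ A n)) ⟩
    θ A                ≈⟨ unit (θ A) ⟩
    𝟙 ⊛ θ A ⊛ 𝟙        ∎
    where
    open ≈-Reasoning
    unit : ∀ X → X ≈ 𝟙 ⊛ X ⊛ 𝟙
    unit = solve 1 (λ X → X := con 1ℤ :* X :* con 1ℤ) ≈-refl
  θ-⊛^ A (suc j) = begin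
    θ (A ⊛ A ⊛^ suc j)
      ≈⟨ θ-⊛ A (A ⊛^ suc j) ⟩
    θ A ⊛ A ⊛^ suc j ⊕ A ⊛ θ (A ⊛^ suc j)
      ≈⟨ ⊕-congˡ (θ A ⊛ A ⊛^ suc j) (⊛-congˡ A (θ-⊛^ A j)) ⟩
    θ A ⊛ (A ⊛ A ⊛^ j) ⊕ A ⊛ ([ ℤ.+ suc j ] ⊛ θ A ⊛ A ⊛^ j)
      ≈⟨ collect (θ A) A (A ⊛^ j) [ ℤ.+ suc j ] ⟩
    ([ 1ℤ ] ⊕ [ ℤ.+ suc j ]) ⊛ θ A ⊛ (A ⊛ A ⊛^ j)
      ≈⟨ ⊛-congʳ (A ⊛ A ⊛^ j) (⊛-congʳ (θ A) (≈-sym ([]-+ 1ℤ (ℤ.+ suc j)))) ⟩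
    [ ℤ.+ suc (suc j) ] ⊛ θ A ⊛ A ⊛^ suc j ∎
    where
    open ≈-Reasoning
    collect : ∀ D A R K → D ⊛ (A ⊛ R) ⊕ A ⊛ (K ⊛ D ⊛ R) ≈ (𝟙 ⊕ K) ⊛ D ⊛ (A ⊛ R)
    collect = solve 4 (λ D A R K → D :* (A :* R) :+ A :* (K :* D :* R) := (con 1ℤ :+ K) :* D :* (A :* R)) ≈-refl

  -- W is the logarithmic derivative t A′/A; when A = ∏ᵢ (1 − αᵢ t), the coefficients of −W
  -- are the power sums Σᵢ αᵢⁿ.
  LogDerivative : Series → Series → Set
  LogDerivative A W = A ⊛ W ≈ θ A

  logDerivative-cong : ∀ {A A′ W W′} → A ≈ A′ → W ≈ W′ → LogDerivative A W → LogDerivative A′ W′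
  logDerivative-cong {A} {A′} {W} {W′} A≈A′ W≈W′ AW≈θA = begin
    A′ ⊛ W′ ≈⟨ ⊛-cong (≈-sym A≈A′) (≈-sym W≈W′) ⟩
    A ⊛ W   ≈⟨ AW≈θA ⟩
    θ A     ≈⟨ θ-cong A≈A′ ⟩
    θ A′    ∎
    where open ≈-Reasoning

  logDerivative-⊛ : ∀ {A B U V} → LogDerivative A U → LogDerivative B V → LogDerivative (A ⊛ B) (U ⊕ V)
  logDerivative-⊛ {A} {B} {U} {V} AU≈θA BV≈θB = begin
    A ⊛ B ⊛ (U ⊕ V)               ≈⟨ expand A B U V ⟩
    B ⊛ (A ⊛ U) ⊕ A ⊛ (B ⊛ V)     ≈⟨ ⊕-cong (⊛-congˡ B AU≈θA) (⊛-congˡ A BV≈θB) ⟩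
    B ⊛ θ A ⊕ A ⊛ θ B             ≈⟨ ⊕-congʳ (A ⊛ θ B) (⊛-comm B (θ A)) ⟩
    θ A ⊛ B ⊕ A ⊛ θ B             ≈⟨ ≈-sym (θ-⊛ A B) ⟩
    θ (A ⊛ B)                     ∎
    where
    open ≈-Reasoning
    expand : ∀ A B U V → A ⊛ B ⊛ (U ⊕ V) ≈ B ⊛ (A ⊛ U) ⊕ A ⊛ (B ⊛ V)
    expand = solve 4 (λ A B U V → A :* B :* (U :+ V) := B :* (A :* U) :+ A :* (B :* V)) ≈-refl

  logDerivative-inverse : ∀ {F G U} → F ⊛ G ≈ 𝟙 → LogDerivative F U → LogDerivative G (⊝ U)
  logDerivative-inverse {F} {G} {U} FG≈1 FU≈θF = begin
    G ⊛ ⊝ U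
      ≈⟨ ⊛-congˡ G (⊝-cong (⊛-identityˡ U)) ⟨
    G ⊛ ⊝ (𝟙 ⊛ U)
      ≈⟨ ⊛-congˡ G (⊝-cong (⊛-congʳ U FG≈1)) ⟨
    G ⊛ ⊝ (F ⊛ G ⊛ U)
      ≈⟨ rearrange F G U ⟩
    G ⊛ ⊝ (F ⊛ U ⊛ G)
      ≈⟨ ⊛-congˡ G (λ n → ℤ.+-identityˡ _) ⟨
    G ⊛ (𝟘 ⊕ ⊝ (F ⊛ U ⊛ G))
      ≈⟨ ⊛-congˡ G (⊕-cong (≈-trans (θ-cong FG≈1) (θ-[] 1ℤ)) (⊝-cong (⊛-congʳ G (≈-sym FU≈θF)))) ⟨
    G ⊛ (θ (F ⊛ G) ⊕ ⊝ (θ F ⊛ G))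
      ≈⟨ ⊛-congˡ G (⊕-congʳ (⊝ (θ F ⊛ G)) (θ-⊛ F G)) ⟩
    G ⊛ (θ F ⊛ G ⊕ F ⊛ θ G ⊕ ⊝ (θ F ⊛ G))
      ≈⟨ cancel G F (θ F) (θ G) ⟩
    F ⊛ G ⊛ θ G
      ≈⟨ ⊛-congʳ (θ G) FG≈1 ⟩
    𝟙 ⊛ θ G
      ≈⟨ ⊛-identityˡ (θ G) ⟩
    θ G ∎
    where
    open ≈-Reasoning
    rearrange : ∀ F G U → G ⊛ ⊝ (F ⊛ G ⊛ U) ≈ G ⊛ ⊝ (F ⊛ U ⊛ G)
    rearrange = solve 3 (λ F G U → G :* (:- (F :* G :* U)) := G :* (:- (F :* U :* G))) ≈-refl
    cancel : ∀ G F DF DG → G ⊛ (DF ⊛ G ⊕ F ⊛ DG ⊕ ⊝ (DF ⊛ G)) ≈ F ⊛ G ⊛ DG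
    cancel = solve 4 (λ G F DF DG → G :* (DF :* G :+ F :* DG :+ :- (DF :* G)) := F :* G :* DG) ≈-refl

  infix 4 _≈[<_]_
  _≈[<_]_ : Series → ℕ → Series → Set
  A ≈[< d ] B = ∀ i → i ℕ.< d → A i ≡ B i

  ≈[<]-⊛ : ∀ {d A B} C → A ≈[< d ] B → A ⊛ C ≈[< d ] B ⊛ C
  ≈[<]-⊛ C A≈B zero    0<d = cong (_* C 0) (A≈B 0 0<d)
  ≈[<]-⊛ {suc d} C A≈B (suc i) (ℕ.s≤s i<d) =
    cong₂ _+_ (cong (_* C (suc i)) (A≈B 0 ℕ.z<s)) (≈[<]-⊛ C (λ j j<d → A≈B (suc j) (ℕ.s≤s j<d)) i i<d)

  logDerivative-≈[<]𝟙 : ∀ {d A W} → A ≈[< d ] 𝟙 → LogDerivative A W → W ≈[< d ] 𝟘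
  logDerivative-≈[<]𝟙 {d} {A} {W} A≈1 AW≈θA i i<d = begin
    W i               ≡⟨ ⊛-identityˡ W i ⟨
    (𝟙 ⊛ W) i         ≡⟨ ≈[<]-⊛ W A≈1 i i<d ⟨
    (A ⊛ W) i         ≡⟨ AW≈θA i ⟩
    ℤ.+ i * A i       ≡⟨ cong (ℤ.+ i *_) (A≈1 i i<d) ⟩
    ℤ.+ i * 𝟙 i       ≡⟨ θ-[] 1ℤ i ⟩
    0ℤ                ∎
    where open ≡-Reasoning

  infix 4 _∣ₛ_
  _∣ₛ_ : ℤ → Series → Set
  N ∣ₛ A = ∀ n → N ∣ A n

  ∣ₛ-⊛ : ∀ {N A} B → N ∣ₛ A → N ∣ₛ A ⊛ B
  ∣ₛ-⊛ B N∣A zero    = ∣m⇒∣m*n (B 0) (N∣A 0)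
  ∣ₛ-⊛ B N∣A (suc n) = ∣m∣n⇒∣m+n (∣m⇒∣m*n (B (suc n)) (N∣A 0)) (∣ₛ-⊛ B (N∣A ∘ suc) n)

  ≡0⇒∣ : ∀ {N z} → z ≡ 0ℤ → N ∣ z
  ≡0⇒∣ = divides 0ℤ

  *-pres-∣ : ∀ {a b c d} → a ∣ b → c ∣ d → a * c ∣ b * d
  *-pres-∣ {b = b} {c} a∣b c∣d = ∣-trans (*-monoˡ-∣ c a∣b) (*-monoʳ-∣ b c∣d)

  p∣x⇒pᶜ∣xᶜ : ∀ {p x} c → ℤ.+ p ∣ x → ℤ.+ (p ℕ.^ c) ∣ x ^ c
  p∣x⇒pᶜ∣xᶜ zero    _   = ∣-refl
  p∣x⇒pᶜ∣xᶜ {p} (suc c) p∣x = subst (_∣ _) (sym (ℤ.pos-* p (p ℕ.^ c))) (*-pres-∣ p∣x (p∣x⇒pᶜ∣xᶜ c p∣x))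

  module _ (x : ℤ) (d : ℕ) .{{_ : NonZero d}} where

    -- The expansion of 1 / (1 − x tᵈ).
    geometric : Series
    geometric n = if does (d ℕ.∣? n) then x ^ (n ℕ./ d) else 0ℤ

    private
      G : Series
      G = geometric

    geometric-∣ : ∀ {n} → d ℕ.∣ n → G n ≡ x ^ (n ℕ./ d)
    geometric-∣ {n} = if-yes (d ℕ.∣? n)

    geometric-∤ : ∀ {n} → ¬ d ℕ.∣ n → G n ≡ 0ℤ
    geometric-∤ {n} = if-no (d ℕ.∣? n)

    geometric-≈[<]𝟙 : G ≈[< d ] 𝟙
    geometric-≈[<]𝟙 zero    _   = trans (geometric-∣ (d ℕ.∣0)) (cong (x ^_) (ℕ.0/n≡0 d))
    geometric-≈[<]𝟙 (suc n) n<d = geometric-∤ λ d∣n → ℕ.<⇒≱ n<d (ℕ.∣⇒≤ d∣n)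

    geometric-+ : ∀ j → G (d ℕ.+ j) ≡ x * G j
    geometric-+ j with d ℕ.∣? j
    ... | yes d∣j = begin
      G (d ℕ.+ j)
        ≡⟨ geometric-∣ (ℕ.∣m∣n⇒∣m+n ℕ.∣-refl d∣j) ⟩
      x ^ ((d ℕ.+ j) ℕ./ d)
        ≡⟨ cong (x ^_) (trans (ℕ.+-distrib-/-∣ˡ j ℕ.∣-refl) (cong (ℕ._+ j ℕ./ d) (ℕ.n/n≡1 d))) ⟩
      x * x ^ (j ℕ./ d) ∎
      where open ≡-Reasoning
    ... | no  d∤j = begin
      G (d ℕ.+ j)   ≡⟨ geometric-∤ (λ d∣d+j → d∤j (ℕ.∣m+n∣m⇒∣n d∣d+j ℕ.∣-refl)) ⟩
      0ℤ            ≡⟨ ℤ.*-zeroʳ x ⟨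
      x * 0ℤ        ∎
      where open ≡-Reasoning

    geometric-unfold : G ≈ 𝟙 ⊕ x ∙ shift d G
    geometric-unfold n with n ℕ.<? d
    ... | yes n<d = begin
      G n                    ≡⟨ geometric-≈[<]𝟙 n n<d ⟩
      𝟙 n                    ≡⟨ ℤ.+-identityʳ (𝟙 n) ⟨
      𝟙 n + 0ℤ               ≡⟨ cong (𝟙 n +_) (trans (cong (x *_) (shift-< d G n<d)) (ℤ.*-zeroʳ x)) ⟨
      𝟙 n + x * shift d G n  ∎
      where open ≡-Reasoning
    ... | no  n≮d with ℕ.m≤n⇒∃[o]m+o≡n (ℕ.≮⇒≥ n≮d)
    ...   | j , refl = begin
      G (d ℕ.+ j)
        ≡⟨ geometric-+ j ⟩
      x * G j
        ≡⟨ cong (x *_) (shift-+ d G j) ⟨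
      x * shift d G (d ℕ.+ j)
        ≡⟨ ℤ.+-identityˡ _ ⟨
      0ℤ + x * shift d G (d ℕ.+ j)
        ≡⟨ cong (_+ x * shift d G (d ℕ.+ j)) (𝟙-pos (ℕ.<-≤-trans (ℕ.>-nonZero⁻¹ d) (ℕ.m≤m+n d j))) ⟨
      𝟙 (d ℕ.+ j) + x * shift d G (d ℕ.+ j) ∎
      where open ≡-Reasoning

    geometric⊛-unfold : ∀ A → G ⊛ A ≈ A ⊕ x ∙ shift d (G ⊛ A)
    geometric⊛-unfold A i = begin
      (G ⊛ A) i
        ≡⟨ ⊛-congʳ A geometric-unfold i ⟩
      ((𝟙 ⊕ x ∙ shift d G) ⊛ A) i
        ≡⟨ ⊛-distribʳ-⊕ 𝟙 (x ∙ shift d G) A i ⟩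
      (𝟙 ⊛ A) i + (x ∙ shift d G ⊛ A) i
        ≡⟨ cong₂ _+_ (⊛-identityˡ A i) (trans (∙-⊛ x (shift d G) A i) (cong (x *_) (shift-⊛ d G A i))) ⟩
      A i + x * shift d (G ⊛ A) i ∎
      where open ≡-Reasoning

    geometric⊛-divisible : ∀ {N A} → N ∣ x → N ∣ₛ A ⊕ ⊝ 𝟙 → N ∣ₛ G ⊛ A ⊕ ⊝ 𝟙
    geometric⊛-divisible {N} {A} N∣x N∣A-1 i =
      subst (N ∣_) (sym (trans (cong (_+ - 𝟙 i) (geometric⊛-unfold A i)) (regroup (A i) _ (𝟙 i))))
            (∣m∣n⇒∣m+n (N∣A-1 i) (∣m⇒∣m*n (shift d (G ⊛ A) i) N∣x))
      where
      regroup : ∀ a y o → a + y + - o ≡ (a + - o) + y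
      regroup = solve-∀

    geometric-inverse : (𝟙 ⊕ ⊝ ([ x ] ⊛ t^ d)) ⊛ G ≈ 𝟙
    geometric-inverse = begin
      (𝟙 ⊕ ⊝ ([ x ] ⊛ t^ d)) ⊛ G
        ≈⟨ distribute G [ x ] (t^ d) ⟩
      G ⊕ ⊝ ([ x ] ⊛ (t^ d ⊛ G))
        ≈⟨ ⊕-congˡ G (⊝-cong λ n → trans ([]-⊛ x _ n) (cong (x *_) (t^-⊛ d G n))) ⟩
      G ⊕ ⊝ (x ∙ shift d G)
        ≈⟨ ⊕-congʳ (⊝ (x ∙ shift d G)) geometric-unfold ⟩
      𝟙 ⊕ x ∙ shift d G ⊕ ⊝ (x ∙ shift d G)
        ≈⟨ (λ n → a+b-b≡a (𝟙 n) (x * shift d G n)) ⟩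
      𝟙 ∎
      where
      open ≈-Reasoning
      distribute : ∀ G X T → (𝟙 ⊕ ⊝ (X ⊛ T)) ⊛ G ≈ G ⊕ ⊝ (X ⊛ (T ⊛ G))
      distribute = solve 3 (λ G X T → (con 1ℤ :+ :- (X :* T)) :* G := G :+ :- (X :* (T :* G))) ≈-refl
      a+b-b≡a : ∀ a b → a + b + - b ≡ a
      a+b-b≡a = solve-∀

    logDerivative-geometric : LogDerivative G ([ ℤ.+ d ] ⊛ (G ⊕ ⊝ 𝟙))
    logDerivative-geometric =
      logDerivative-cong ≈-refl (negate-twice [ ℤ.+ d ] (G ⊕ ⊝ 𝟙))
                         (logDerivative-inverse geometric-inverse F⊛U≈θF)
      where
      open ≈-Reasoning
      F D : Series
      F = 𝟙 ⊕ ⊝ ([ x ] ⊛ t^ d)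
      D = [ ℤ.+ d ]
      negate-twice : ∀ D A → ⊝ (⊝ D ⊛ A) ≈ D ⊛ A
      negate-twice = solve 2 (λ D A → :- (:- D :* A) := D :* A) ≈-refl
      expand : ∀ F D G → F ⊛ (⊝ D ⊛ (G ⊕ ⊝ 𝟙)) ≈ ⊝ D ⊛ (F ⊛ G ⊕ ⊝ F)
      expand = solve 3 (λ F D G → F :* (:- D :* (G :+ :- con 1ℤ)) := :- D :* (F :* G :+ :- F)) ≈-refl
      simplify : ∀ D X T → ⊝ D ⊛ (𝟙 ⊕ ⊝ (𝟙 ⊕ ⊝ (X ⊛ T))) ≈ ⊝ (X ⊛ (D ⊛ T))
      simplify = solve 3 (λ D X T → :- D :* (con 1ℤ :+ :- (con 1ℤ :+ :- (X :* T))) := :- (X :* (D :* T))) ≈-refl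
      θ[xtᵈ] : θ ([ x ] ⊛ t^ d) ≈ [ x ] ⊛ (D ⊛ t^ d)
      θ[xtᵈ] = ≈-trans (θ-[]⊛ x (t^ d)) (⊛-congˡ [ x ] (θ-t^ d))
      F⊛U≈θF : LogDerivative F (⊝ D ⊛ (G ⊕ ⊝ 𝟙))
      F⊛U≈θF = begin
        F ⊛ (⊝ D ⊛ (G ⊕ ⊝ 𝟙))
          ≈⟨ expand F D G ⟩
        ⊝ D ⊛ (F ⊛ G ⊕ ⊝ F)
          ≈⟨ ⊛-congˡ (⊝ D) (⊕-congʳ (⊝ F) geometric-inverse) ⟩
        ⊝ D ⊛ (𝟙 ⊕ ⊝ F)
          ≈⟨ simplify D [ x ] (t^ d) ⟩
        ⊝ ([ x ] ⊛ (D ⊛ t^ d))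
          ≈⟨ (λ n → ℤ.+-identityˡ _) ⟨
        𝟘 ⊕ ⊝ ([ x ] ⊛ (D ⊛ t^ d))
          ≈⟨ ⊕-cong (θ-[] 1ℤ) (≈-trans (θ-⊝ _) (⊝-cong θ[xtᵈ])) ⟨
        θ 𝟙 ⊕ θ (⊝ ([ x ] ⊛ t^ d))
          ≈⟨ θ-⊕ 𝟙 (⊝ ([ x ] ⊛ t^ d)) ⟨
        θ F ∎

    geometric-divisible : ∀ {p} → Prime p → ℤ.+ p ∣ x → ∀ {k n} → p ℕ.^ k ℕ.∣ n →
                          ℤ.+ (p ℕ.^ suc k) ∣ ([ ℤ.+ d ] ⊛ (G ⊕ ⊝ 𝟙)) n
    geometric-divisible {p} p-prime p∣x {k} {n} pᵏ∣n =
      subst (_ ∣_) (sym ([]-⊛ (ℤ.+ d) (G ⊕ ⊝ 𝟙) n)) (divisible n pᵏ∣n)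
      where
      divisible : ∀ n → p ℕ.^ k ℕ.∣ n → ℤ.+ (p ℕ.^ suc k) ∣ ℤ.+ d * (G n - 𝟙 n)
      divisible zero _ = ≡0⇒∣ d*[G₀-1]≡0
        where
        d*[G₀-1]≡0 : ℤ.+ d * (G 0 - 1ℤ) ≡ 0ℤ
        d*[G₀-1]≡0 =
          trans (cong (λ g → ℤ.+ d * (g - 1ℤ)) (geometric-≈[<]𝟙 0 (ℕ.>-nonZero⁻¹ d))) (ℤ.*-zeroʳ (ℤ.+ d))
      divisible (suc n) pᵏ∣n with d ℕ.∣? suc n
      ... | no  _ = ≡0⇒∣ (ℤ.*-zeroʳ (ℤ.+ d))
      ... | yes (ℕ.divides c eq) =
        subst (_ ∣_) (sym coefficient≡) (∣-trans pᵏ⁺¹∣d*pᶜ (*-monoʳ-∣ (ℤ.+ d) (p∣x⇒pᶜ∣xᶜ c p∣x)))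
        where
        instance
          c≢0 : NonZero c
          c≢0 = ℕ.≢-nonZero λ c≡0 → ℕ.1+n≢0 (trans eq (cong (ℕ._* d) c≡0))
        coefficient≡ : ℤ.+ d * (x ^ (suc n ℕ./ d) - 0ℤ) ≡ ℤ.+ d * x ^ c
        coefficient≡ =
          cong (ℤ.+ d *_) (trans (ℤ.+-identityʳ _) (cong (x ^_) (trans (cong (ℕ._/ d) eq) (ℕ.m*n/n≡m c d))))
        pᵏ⁺¹∣d*pᶜ : ℤ.+ (p ℕ.^ suc k) ∣ ℤ.+ d * ℤ.+ (p ℕ.^ c)
        pᵏ⁺¹∣d*pᶜ = subst (_ ∣_) (ℤ.pos-* d (p ℕ.^ c))
                          (∣ᵤ⇒∣ (pᵏ∣c*d⇒p¹⁺ᵏ∣d*pᶜ p-prime k {c} {d} (subst (p ℕ.^ k ℕ.∣_) eq pᵏ∣n)))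

  geometric⊛-≈[<]𝟙 : ∀ d .{{_ : NonZero d}} {A} → A ≈[< d ] 𝟙 → geometric (- A d) d ⊛ A ≈[< suc d ] 𝟙
  geometric⊛-≈[<]𝟙 d {A} A≈1 i i<1+d with ℕ.<-cmp i d
  ... | tri< i<d _ _ = begin
    A′ i                          ≡⟨ geometric⊛-unfold x d A i ⟩
    A i + x * shift d A′ i        ≡⟨ cong (λ s → A i + x * s) (shift-< d A′ i<d) ⟩
    A i + x * 0ℤ                  ≡⟨ cong (A i +_) (ℤ.*-zeroʳ x) ⟩
    A i + 0ℤ                      ≡⟨ ℤ.+-identityʳ (A i) ⟩
    A i                           ≡⟨ A≈1 i i<d ⟩
    𝟙 i                           ∎
    where
    open ≡-Reasoning
    x : ℤ
    x = - A d
    A′ : Series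
    A′ = geometric x d ⊛ A
  ... | tri≈ _ refl _ = begin
    A′ d
      ≡⟨ geometric⊛-unfold x d A d ⟩
    A d + x * shift d A′ d
      ≡⟨ cong (λ s → A d + x * s) (trans (cong (shift d A′) (sym (ℕ.+-identityʳ d))) (shift-+ d A′ 0)) ⟩
    A d + x * A′ 0
      ≡⟨ cong (λ a → A d + x * a) (cong₂ _*_ (geometric-≈[<]𝟙 x d 0 0<d) (A≈1 0 0<d)) ⟩
    A d + x * 1ℤ
      ≡⟨ cong (A d +_) (ℤ.*-identityʳ x) ⟩
    A d + - A d
      ≡⟨ ℤ.+-inverseʳ (A d) ⟩
    0ℤ
      ≡⟨ 𝟙-pos 0<d ⟨
    𝟙 d ∎
    where
    open ≡-Reasoning
    x : ℤ
    x = - A d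
    A′ : Series
    A′ = geometric x d ⊛ A
    0<d : 0 ℕ.< d
    0<d = ℕ.>-nonZero⁻¹ d
  ... | tri> _ _ d<i = ⊥-elim (ℕ.<⇒≱ d<i (ℕ.≤-pred i<1+d))

  module _ {p : ℕ} (p-prime : Prime p) {k n : ℕ} (pᵏ∣n : p ℕ.^ k ℕ.∣ n) where

    private
      pᵏ⁺¹ : ℤ
      pᵏ⁺¹ = ℤ.+ (p ℕ.^ suc k)

    -- Recursion on gap > n − d: A′ = A/(1 + A_d tᵈ) is ≡ 1 modulo t^(d+1), and its logarithmic
    -- derivative differs from W by that of 1/(1 + A_d tᵈ), whose n-th coefficient is divisible by p^(k+1).
    logDerivative-divisible-from : ∀ gap d .{{_ : NonZero d}} {A W} → n ℕ.< gap ℕ.+ d →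
      A ≈[< d ] 𝟙 → ℤ.+ p ∣ₛ A ⊕ ⊝ 𝟙 → LogDerivative A W → pᵏ⁺¹ ∣ W n
    logDerivative-divisible-from gap d {A} {W} n<gap+d A≈1 p∣A-1 AW≈θA with n ℕ.<? d
    ... | yes n<d = ≡0⇒∣ (logDerivative-≈[<]𝟙 A≈1 AW≈θA n n<d)
    logDerivative-divisible-from zero      d n<d _ _ _ | no n≮d = ⊥-elim (n≮d n<d)
    logDerivative-divisible-from (suc gap) d {A} {W} n<gap+d A≈1 p∣A-1 AW≈θA | no n≮d =
      ∣m+n∣m⇒∣n (logDerivative-divisible-from gap (suc d) n<gap+1+d A′≈1 p∣A′-1 A′-logDerivative)
                (geometric-divisible x d p-prime p∣x {k} pᵏ∣n)
      where
      x : ℤ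
      x = - A d
      A′ : Series
      A′ = geometric x d ⊛ A
      p∣x : ℤ.+ p ∣ x
      p∣x = ∣m⇒∣-m (subst (ℤ.+ p ∣_) Ad-1≡Ad (p∣A-1 d))
        where
        Ad-1≡Ad : A d - 𝟙 d ≡ A d
        Ad-1≡Ad = trans (cong (λ o → A d - o) (𝟙-pos (ℕ.>-nonZero⁻¹ d))) (ℤ.+-identityʳ (A d))
      n<gap+1+d : n ℕ.< gap ℕ.+ suc d
      n<gap+1+d = subst (n ℕ.<_) (sym (ℕ.+-suc gap d)) n<gap+d
      A′≈1 : A′ ≈[< suc d ] 𝟙
      A′≈1 = geometric⊛-≈[<]𝟙 d A≈1
      p∣A′-1 : ℤ.+ p ∣ₛ A′ ⊕ ⊝ 𝟙
      p∣A′-1 = geometric⊛-divisible x d p∣x p∣A-1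
      A′-logDerivative : LogDerivative A′ ([ ℤ.+ d ] ⊛ (geometric x d ⊕ ⊝ 𝟙) ⊕ W)
      A′-logDerivative = logDerivative-⊛ (logDerivative-geometric x d) AW≈θA

    logDerivative-divisible : ∀ {A W} → A 0 ≡ 1ℤ → ℤ.+ p ∣ₛ A ⊕ ⊝ 𝟙 → LogDerivative A W → pᵏ⁺¹ ∣ W n
    logDerivative-divisible A₀≡1 =
      logDerivative-divisible-from n 1 (ℕ.m<m+n n ℕ.z<s) λ { zero _ → A₀≡1 ; (suc _) (ℕ.s≤s ()) }

  geometric-1 : ∀ d .{{_ : NonZero d}} n → geometric 1ℤ d n ≡ ℤ.+ indicator (d ℕ.∣? n)
  geometric-1 d n with d ℕ.∣? n
  ... | yes _ = ℤ.^-zeroˡ (n ℕ./ d)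
  ... | no  _ = refl

module BinomialSumSeries where
  open import Data.Nat as ℕ using (ℕ; zero; suc)
  import Data.Nat.Properties as ℕ
  import Data.Nat.Divisibility as ℕ
  open import Data.Nat.Primality using (Prime; prime[2]; prime⇒irreducible)
  open import Data.Nat.Combinatorics using (_C_; nCk+nC[k+1]≡[n+1]C[k+1]; nCn≡1)
  open import Data.Nat.Combinatorics.Specification using (k>n⇒nCk≡0)
  open import Data.Integer as ℤ using (ℤ; _+_; _-_; _*_; -_; 0ℤ; 1ℤ; _^_)
  import Data.Integer.Properties as ℤ
  open import Data.Integer.Divisibility.Signed using (_∣_; ∣-refl; ∣m∣n⇒∣m+n; ∣m⇒∣-m; ∣n⇒∣m*n; ∣ᵤ⇒∣)
  open import Data.Integer.Tactic.RingSolver using (solve-∀)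
  open PowerSeries

  P : Series
  P = 𝟙 ⊕ ⊝ t^ 1

  P-⊛ : ∀ B → P ⊛ B ≈ B ⊕ ⊝ shift 1 B
  P-⊛ B = begin
    P ⊛ B                       ≈⟨ distribute B (t^ 1) ⟩
    𝟙 ⊛ B ⊕ ⊝ (t^ 1 ⊛ B)        ≈⟨ ⊕-cong (⊛-identityˡ B) (⊝-cong (t^-⊛ 1 B)) ⟩
    B ⊕ ⊝ shift 1 B             ∎
    where
    open ≈-Reasoning
    distribute : ∀ B T → (𝟙 ⊕ ⊝ T) ⊛ B ≈ 𝟙 ⊛ B ⊕ ⊝ (T ⊛ B)
    distribute = solve 2 (λ B T → (con 1ℤ :+ :- T) :* B := con 1ℤ :* B :+ :- (T :* B)) ≈-refl

  θ-P : θ P ≈ ⊝ t^ 1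
  θ-P zero          = refl
  θ-P (suc zero)    = refl
  θ-P (suc (suc n)) = ℤ.*-zeroʳ (ℤ.+ suc (suc n))

  P-inverse : P ⊛ geometric 1ℤ 1 ≈ 𝟙
  P-inverse = ≈-trans (⊛-congʳ (geometric 1ℤ 1) (⊕-congˡ 𝟙 (⊝-cong (≈-sym (⊛-identityˡ (t^ 1))))))
                      (geometric-inverse 1ℤ 1)

  logDerivative-P : LogDerivative P (⊝ ([ 1ℤ ] ⊛ (geometric 1ℤ 1 ⊕ ⊝ 𝟙)))
  logDerivative-P = logDerivative-inverse (≈-trans (⊛-comm (geometric 1ℤ 1) P) P-inverse) (logDerivative-geometric 1ℤ 1)

  P^-coefficient : ∀ j i → (P ⊛^ j) i ≡ (- 1ℤ) ^ i * ℤ.+ (j C i)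
  P^-coefficient zero    zero    = refl
  P^-coefficient zero    (suc i) = sym (ℤ.*-zeroʳ ((- 1ℤ) ^ suc i))
  P^-coefficient (suc j) zero    = trans (P-⊛ (P ⊛^ j) 0) (trans (ℤ.+-identityʳ _) (P^-coefficient j 0))
  P^-coefficient (suc j) (suc i) = begin
    (P ⊛ P ⊛^ j) (suc i)
      ≡⟨ P-⊛ (P ⊛^ j) (suc i) ⟩
    (P ⊛^ j) (suc i) - (P ⊛^ j) i
      ≡⟨ cong₂ _-_ (P^-coefficient j (suc i)) (P^-coefficient j i) ⟩
    - 1ℤ * s * ℤ.+ (j C suc i) - s * ℤ.+ (j C i)
      ≡⟨ collect s (ℤ.+ (j C suc i)) (ℤ.+ (j C i)) ⟩
    - 1ℤ * s * (ℤ.+ (j C i) + ℤ.+ (j C suc i))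
      ≡⟨ cong (λ c → - 1ℤ * s * ℤ.+ c) (nCk+nC[k+1]≡[n+1]C[k+1] j i) ⟩
    - 1ℤ * s * ℤ.+ (suc j C suc i) ∎
    where
    open ≡-Reasoning
    s : ℤ
    s = (- 1ℤ) ^ i
    collect : ∀ s a b → - 1ℤ * s * a - s * b ≡ - 1ℤ * s * (b + a)
    collect = solve-∀

  -1^-parity : ∀ n → (2 ℕ.∣ n × (- 1ℤ) ^ n ≡ 1ℤ) ⊎ (2 ℕ.∣ suc n × (- 1ℤ) ^ n ≡ - 1ℤ)
  -1^-parity zero = inj₁ (2 ℕ.∣0 , refl)
  -1^-parity (suc n) with -1^-parity n
  ... | inj₁ (2∣n , sₙ≡1)    = inj₂ (ℕ.∣m∣n⇒∣m+n (ℕ.∣-refl {2}) 2∣n , cong (- 1ℤ *_) sₙ≡1)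
  ... | inj₂ (2∣1+n , sₙ≡-1) = inj₁ (2∣1+n , cong (- 1ℤ *_) sₙ≡-1)

  p∣[-1]^pᵉ⁺¹+1 : ∀ {p} → Prime p → ∀ e → ℤ.+ p ∣ (- 1ℤ) ^ (p ℕ.^ suc e) + 1ℤ
  p∣[-1]^pᵉ⁺¹+1 {p} p-prime e with -1^-parity (p ℕ.^ suc e)
  ... | inj₂ (_ , s≡-1) = ≡0⇒∣ (cong (_+ 1ℤ) s≡-1)
  ... | inj₁ (2∣pᵉ⁺¹ , s≡1) with prime⇒irreducible p-prime (prime∣m^[1+n]⇒prime∣m prime[2] e 2∣pᵉ⁺¹)
  ...   | inj₂ refl = subst (ℤ.+ 2 ∣_) (sym (cong (_+ 1ℤ) s≡1)) ∣-refl
  ...   | inj₁ ()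

  module _ (m′ : ℕ) where

    private
      m : ℕ
      m = suc m′
      ones : Series
      ones = geometric 1ℤ 1
    open ResidueSums m

    residueSeries : ℕ → Series
    residueSeries r n = ℤ.+ residueSum r n

    private
      𝒱 : ℕ → Series
      𝒱 = residueSeries

    P⊛residueSeries-suc : ∀ r → P ⊛ 𝒱 (suc r) ≈ t^ 1 ⊛ 𝒱 r
    P⊛residueSeries-suc r n = trans (P-⊛ (𝒱 (suc r)) n) (trans (pascal n) (sym (t^-⊛ 1 (𝒱 r) n)))
      where
      x+y-x≡y : ∀ x y → x + y - x ≡ y
      x+y-x≡y = solve-∀
      pascal : ∀ n → 𝒱 (suc r) n - shift 1 (𝒱 (suc r)) n ≡ shift 1 (𝒱 r) n
      pascal zero    = refl
      pascal (suc n) =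
        trans (cong (λ v → ℤ.+ v - 𝒱 (suc r) n) (residueSum-pascal r n)) (x+y-x≡y (𝒱 (suc r) n) (𝒱 r n))

    P⊛residueSeries-zero : P ⊛ 𝒱 0 ≈ 𝟙 ⊕ P ⊛ 𝒱 m
    P⊛residueSeries-zero = begin
      P ⊛ 𝒱 0                 ≈⟨ ⊛-congˡ P 𝒱₀≈ones+𝒱ₘ ⟩
      P ⊛ (ones ⊕ 𝒱 m)        ≈⟨ distribute P ones (𝒱 m) ⟩
      P ⊛ ones ⊕ P ⊛ 𝒱 m      ≈⟨ ⊕-congʳ (P ⊛ 𝒱 m) P-inverse ⟩
      𝟙 ⊕ P ⊛ 𝒱 m             ∎
      where
      open ≈-Reasoning
      𝒱₀≈ones+𝒱ₘ : 𝒱 0 ≈ ones ⊕ 𝒱 m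
      𝒱₀≈ones+𝒱ₘ n = trans (cong ℤ.+_ (residueSum-zero n)) (cong (_+ 𝒱 m n) (sym ones≡1))
        where
        ones≡1 : ones n ≡ 1ℤ
        ones≡1 = trans (geometric-1 1 n) (cong ℤ.+_ (if-yes (1 ℕ.∣? n) (ℕ.1∣ n)))
      distribute : ∀ X Y Z → X ⊛ (Y ⊕ Z) ≈ X ⊛ Y ⊕ X ⊛ Z
      distribute = solve 3 (λ X Y Z → X :* (Y :+ Z) := X :* Y :+ X :* Z) ≈-refl

    P^⊛residueSeries : ∀ j → P ⊛^ j ⊛ 𝒱 j ≈ t^ j ⊛ 𝒱 0
    P^⊛residueSeries zero    = ≈-refl
    P^⊛residueSeries (suc j) = begin
      P ⊛ P ⊛^ j ⊛ 𝒱 (suc j)      ≈⟨ reassociate P (P ⊛^ j) (𝒱 (suc j)) ⟩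
      P ⊛^ j ⊛ (P ⊛ 𝒱 (suc j))    ≈⟨ ⊛-congˡ (P ⊛^ j) (P⊛residueSeries-suc j) ⟩
      P ⊛^ j ⊛ (t^ 1 ⊛ 𝒱 j)       ≈⟨ swap (P ⊛^ j) (t^ 1) (𝒱 j) ⟩
      t^ 1 ⊛ (P ⊛^ j ⊛ 𝒱 j)       ≈⟨ ⊛-congˡ (t^ 1) (P^⊛residueSeries j) ⟩
      t^ 1 ⊛ (t^ j ⊛ 𝒱 0)         ≈⟨ ⊛-assoc (t^ 1) (t^ j) (𝒱 0) ⟨
      t^ 1 ⊛ t^ j ⊛ 𝒱 0           ≈⟨ ⊛-congʳ (𝒱 0) (t^-+ 1 j) ⟩
      t^ (suc j) ⊛ 𝒱 0            ∎
      where
      open ≈-Reasoning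
      reassociate : ∀ X Y Z → X ⊛ Y ⊛ Z ≈ Y ⊛ (X ⊛ Z)
      reassociate = solve 3 (λ X Y Z → X :* Y :* Z := Y :* (X :* Z)) ≈-refl
      swap : ∀ X Y Z → X ⊛ (Y ⊛ Z) ≈ Y ⊛ (X ⊛ Z)
      swap = solve 3 (λ X Y Z → X :* (Y :* Z) := Y :* (X :* Z)) ≈-refl

    H : Series
    H = P ⊛^ m ⊕ ⊝ t^ m

    H⊛residueSeries : H ⊛ 𝒱 0 ≈ P ⊛^ m′
    H⊛residueSeries = begin
      (P ⊛ P ⊛^ m′ ⊕ ⊝ t^ m) ⊛ 𝒱 0
        ≈⟨ expand P (P ⊛^ m′) (t^ m) (𝒱 0) ⟩
      P ⊛^ m′ ⊛ (P ⊛ 𝒱 0) ⊕ ⊝ (t^ m ⊛ 𝒱 0)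
        ≈⟨ ⊕-cong (⊛-congˡ (P ⊛^ m′) P⊛residueSeries-zero) (⊝-cong (≈-sym (P^⊛residueSeries m))) ⟩
      P ⊛^ m′ ⊛ (𝟙 ⊕ P ⊛ 𝒱 m) ⊕ ⊝ (P ⊛ P ⊛^ m′ ⊛ 𝒱 m)
        ≈⟨ cancel P (P ⊛^ m′) (𝒱 m) ⟩
      P ⊛^ m′ ∎
      where
      open ≈-Reasoning
      expand : ∀ P Q T V → (P ⊛ Q ⊕ ⊝ T) ⊛ V ≈ Q ⊛ (P ⊛ V) ⊕ ⊝ (T ⊛ V)
      expand = solve 4 (λ P Q T V → (P :* Q :+ :- T) :* V := Q :* (P :* V) :+ :- (T :* V)) ≈-refl
      cancel : ∀ P Q V → Q ⊛ (𝟙 ⊕ P ⊛ V) ⊕ ⊝ (P ⊛ Q ⊛ V) ≈ Q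
      cancel = solve 3 (λ P Q V → Q :* (con 1ℤ :+ P :* V) :+ :- (P :* Q :* V) := Q) ≈-refl

    logDerivative-H : LogDerivative H (⊝ [ ℤ.+ m ] ⊛ (𝒱 0 ⊕ ⊝ 𝟙))
    logDerivative-H = begin
      H ⊛ (⊝ [ ℤ.+ m ] ⊛ (𝒱 0 ⊕ ⊝ 𝟙))
        ≈⟨ expand H [ ℤ.+ m ] (𝒱 0) ⟩
      ⊝ [ ℤ.+ m ] ⊛ (H ⊛ 𝒱 0 ⊕ ⊝ H)
        ≈⟨ ⊛-congˡ (⊝ [ ℤ.+ m ]) (⊕-congʳ (⊝ H) H⊛residueSeries) ⟩
      ⊝ [ ℤ.+ m ] ⊛ (P ⊛^ m′ ⊕ ⊝ (P ⊛ P ⊛^ m′ ⊕ ⊝ t^ m))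
        ≈⟨ simplify [ ℤ.+ m ] (P ⊛^ m′) (t^ 1) (t^ m) ⟩
      [ ℤ.+ m ] ⊛ ⊝ t^ 1 ⊛ P ⊛^ m′ ⊕ ⊝ ([ ℤ.+ m ] ⊛ t^ m)
        ≈⟨ ⊕-cong (⊛-congʳ (P ⊛^ m′) (⊛-congˡ [ ℤ.+ m ] θ-P)) (⊝-cong (θ-t^ m)) ⟨
      [ ℤ.+ m ] ⊛ θ P ⊛ P ⊛^ m′ ⊕ ⊝ θ (t^ m)
        ≈⟨ ⊕-congʳ (⊝ θ (t^ m)) (θ-⊛^ P m′) ⟨
      θ (P ⊛^ m) ⊕ ⊝ θ (t^ m)
        ≈⟨ ≈-trans (θ-⊕ (P ⊛^ m) (⊝ t^ m)) (⊕-congˡ (θ (P ⊛^ m)) (θ-⊝ (t^ m))) ⟨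
      θ H ∎
      where
      open ≈-Reasoning
      expand : ∀ H K V → H ⊛ (⊝ K ⊛ (V ⊕ ⊝ 𝟙)) ≈ ⊝ K ⊛ (H ⊛ V ⊕ ⊝ H)
      expand = solve 3 (λ H K V → H :* (:- K :* (V :+ :- con 1ℤ)) := :- K :* (H :* V :+ :- H)) ≈-refl
      simplify : ∀ K Q T M → ⊝ K ⊛ (Q ⊕ ⊝ ((𝟙 ⊕ ⊝ T) ⊛ Q ⊕ ⊝ M)) ≈ K ⊛ ⊝ T ⊛ Q ⊕ ⊝ (K ⊛ M)
      simplify = solve 4 (λ K Q T M → :- K :* (Q :+ :- ((con 1ℤ :+ :- T) :* Q :+ :- M))
                                    := K :* :- T :* Q :+ :- (K :* M)) ≈-refl

    private
      Ĝ : Series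
      Ĝ = geometric 1ℤ m

    A W : Series
    A = P ⊛ H ⊛ Ĝ
    W = ⊝ ([ 1ℤ ] ⊛ (ones ⊕ ⊝ 𝟙)) ⊕ ⊝ [ ℤ.+ m ] ⊛ (𝒱 0 ⊕ ⊝ 𝟙) ⊕ [ ℤ.+ m ] ⊛ (Ĝ ⊕ ⊝ 𝟙)

    logDerivative-A : LogDerivative A W
    logDerivative-A = logDerivative-⊛ (logDerivative-⊛ logDerivative-P logDerivative-H) (logDerivative-geometric 1ℤ m)

    A₀≡1 : A 0 ≡ 1ℤ
    A₀≡1 = cong₂ (λ r g → P 0 * (P 0 * r - (t^ m) 0) * g) (P^-coefficient m′ 0) (geometric-≈[<]𝟙 1ℤ m 0 ℕ.z<s)

    W-coefficient : ∀ n → W (suc n) ≡ - (1ℤ + ℤ.+ m * ℤ.+ binomSum (suc m) (suc n))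
    W-coefficient n = begin
      W (suc n)                                                  ≡⟨ cong₂ _+_ (cong₂ _+_ W-P W-H) W-Ĝ ⟩
      - 1ℤ + - (ℤ.+ m * (ℤ.+ S + ℤ.+ ind)) + ℤ.+ m * ℤ.+ ind     ≡⟨ collect (ℤ.+ m) (ℤ.+ S) (ℤ.+ ind) ⟩
      - (1ℤ + ℤ.+ m * ℤ.+ S)                                     ∎
      where
      open ≡-Reasoning
      S ind : ℕ
      S = binomSum (suc m) (suc n)
      ind = indicator (m ℕ.∣? suc n)
      W-P : (⊝ ([ 1ℤ ] ⊛ (ones ⊕ ⊝ 𝟙))) (suc n) ≡ - 1ℤ
      W-P = cong -_ (trans ([]-⊛ 1ℤ (ones ⊕ ⊝ 𝟙) (suc n)) (cong (λ o → 1ℤ * (o - 0ℤ)) ones≡1))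
        where
        ones≡1 : ones (suc n) ≡ 1ℤ
        ones≡1 = trans (geometric-1 1 (suc n)) (cong ℤ.+_ (if-yes (1 ℕ.∣? suc n) (ℕ.1∣ suc n)))
      W-H : (⊝ [ ℤ.+ m ] ⊛ (𝒱 0 ⊕ ⊝ 𝟙)) (suc n) ≡ - (ℤ.+ m * (ℤ.+ S + ℤ.+ ind))
      W-H = begin
        (⊝ [ ℤ.+ m ] ⊛ (𝒱 0 ⊕ ⊝ 𝟙)) (suc n)
          ≡⟨ ⊛-congʳ (𝒱 0 ⊕ ⊝ 𝟙) (⊝-[] (ℤ.+ m)) (suc n) ⟩
        ([ - ℤ.+ m ] ⊛ (𝒱 0 ⊕ ⊝ 𝟙)) (suc n)
          ≡⟨ []-⊛ (- ℤ.+ m) (𝒱 0 ⊕ ⊝ 𝟙) (suc n) ⟩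
        - ℤ.+ m * (𝒱 0 (suc n) - 0ℤ)
          ≡⟨ cong (λ v → - ℤ.+ m * (ℤ.+ v - 0ℤ)) (residueSum-binomSum (suc n)) ⟩
        - ℤ.+ m * (ℤ.+ S + ℤ.+ ind - 0ℤ)
          ≡⟨ cong (- ℤ.+ m *_) (ℤ.+-identityʳ _) ⟩
        - ℤ.+ m * (ℤ.+ S + ℤ.+ ind)
          ≡⟨ ℤ.neg-distribˡ-* (ℤ.+ m) _ ⟨
        - (ℤ.+ m * (ℤ.+ S + ℤ.+ ind)) ∎
      W-Ĝ : ([ ℤ.+ m ] ⊛ (Ĝ ⊕ ⊝ 𝟙)) (suc n) ≡ ℤ.+ m * ℤ.+ ind
      W-Ĝ = trans ([]-⊛ (ℤ.+ m) (Ĝ ⊕ ⊝ 𝟙) (suc n))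
                  (cong (ℤ.+ m *_) (trans (ℤ.+-identityʳ _) (geometric-1 m (suc n))))
      collect : ∀ M S I → - 1ℤ + - (M * (S + I)) + M * I ≡ - (1ℤ + M * S)
      collect = solve-∀

    module _ {p e : ℕ} (p-prime : Prime p) (q≡pᵉ⁺¹ : suc m ≡ p ℕ.^ suc e) where

      private
        q : ℕ
        q = suc m

      -- (1 − t)^q ≡ 1 − t^q modulo p, because q is a power of p.
      E : Series
      E = P ⊛^ q ⊕ t^ q ⊕ ⊝ 𝟙

      E-coefficient : ∀ i → E (suc i) ≡ (- 1ℤ) ^ suc i * ℤ.+ (q C suc i) + (t^ q) (suc i)
      E-coefficient i = trans (cong (λ c → c + (t^ q) (suc i) - 0ℤ) (P^-coefficient q (suc i))) (ℤ.+-identityʳ _)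

      p∣E : ℤ.+ p ∣ₛ E
      p∣E zero    = ≡0⇒∣ (cong₂ (λ a b → a + b - 1ℤ) (P^-coefficient q 0) (t^-≢ q {0} λ ()))
      p∣E (suc i) = subst (ℤ.+ p ∣_) (sym (E-coefficient i)) (p∣coefficient (ℕ.<-cmp (suc i) q))
        where
        sᵢ : ℤ
        sᵢ = (- 1ℤ) ^ suc i
        p∣sign : ℤ.+ p ∣ (- 1ℤ) ^ q * 1ℤ + 1ℤ
        p∣sign = subst (λ s → ℤ.+ p ∣ s + 1ℤ) (sym (trans (ℤ.*-identityʳ _) (cong ((- 1ℤ) ^_) q≡pᵉ⁺¹)))
                       (p∣[-1]^pᵉ⁺¹+1 p-prime e)
        p∣coefficient : Tri (suc i ℕ.< q) (suc i ≡ q) (q ℕ.< suc i) → ℤ.+ p ∣ sᵢ * ℤ.+ (q C suc i) + (t^ q) (suc i)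
        p∣coefficient (tri< i<q i≢q _) = ∣m∣n⇒∣m+n (∣n⇒∣m*n sᵢ (∣ᵤ⇒∣ p∣qCi)) (≡0⇒∣ (t^-≢ q i≢q))
          where
          p∣qCi : p ℕ.∣ q C suc i
          p∣qCi = subst (λ r → p ℕ.∣ r C suc i) (sym q≡pᵉ⁺¹)
                        (p∣pᵉCi p-prime (suc e) ℕ.z<s (subst (suc i ℕ.<_) q≡pᵉ⁺¹ i<q))
        p∣coefficient (tri≈ _ i≡q _) =
          subst (λ j → ℤ.+ p ∣ (- 1ℤ) ^ j * ℤ.+ (q C j) + (t^ q) j) (sym i≡q)
                (subst (ℤ.+ p ∣_) (sym (cong₂ (λ c t → (- 1ℤ) ^ q * ℤ.+ c + t) (nCn≡1 q) (t^-≡ q))) p∣sign)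
        p∣coefficient (tri> _ i≢q q<i) =
          ∣m∣n⇒∣m+n (∣n⇒∣m*n sᵢ (≡0⇒∣ (cong ℤ.+_ (k>n⇒nCk≡0 q<i)))) (≡0⇒∣ (t^-≢ q i≢q))

      A-1≈E⊛Ĝ : A ⊕ ⊝ 𝟙 ≈ E ⊛ Ĝ
      A-1≈E⊛Ĝ = begin
        A ⊕ ⊝ 𝟙
          ≈⟨ ⊕-congˡ A (⊝-cong (geometric-inverse 1ℤ m)) ⟨
        P ⊛ (P ⊛ P ⊛^ m′ ⊕ ⊝ t^ m) ⊛ Ĝ ⊕ ⊝ ((𝟙 ⊕ ⊝ ([ 1ℤ ] ⊛ t^ m)) ⊛ Ĝ)
          ≈⟨ factor (t^ 1) (P ⊛^ m′) (t^ m) Ĝ ⟩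
        (P ⊛^ q ⊕ t^ 1 ⊛ t^ m ⊕ ⊝ 𝟙) ⊛ Ĝ
          ≈⟨ ⊛-congʳ Ĝ (⊕-congʳ (⊝ 𝟙) (⊕-congˡ (P ⊛^ q) (t^-+ 1 m))) ⟩
        E ⊛ Ĝ ∎
        where
        open ≈-Reasoning
        factor : ∀ T Q M G → (𝟙 ⊕ ⊝ T) ⊛ ((𝟙 ⊕ ⊝ T) ⊛ Q ⊕ ⊝ M) ⊛ G ⊕ ⊝ ((𝟙 ⊕ ⊝ (𝟙 ⊛ M)) ⊛ G)
                           ≈ ((𝟙 ⊕ ⊝ T) ⊛ ((𝟙 ⊕ ⊝ T) ⊛ Q) ⊕ T ⊛ M ⊕ ⊝ 𝟙) ⊛ G
        factor = solve 4 (λ T Q M G → (con 1ℤ :+ :- T) :* ((con 1ℤ :+ :- T) :* Q :+ :- M) :* G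
                                      :+ :- ((con 1ℤ :+ :- (con 1ℤ :* M)) :* G)
                                   := ((con 1ℤ :+ :- T) :* ((con 1ℤ :+ :- T) :* Q) :+ T :* M :+ :- con 1ℤ) :* G) ≈-refl

      binomSum-congruence : ∀ {k a} → p ℕ.^ k ℕ.∣ suc a →
                            ℤ.+ (p ℕ.^ suc k) ∣ 1ℤ + ℤ.+ m * ℤ.+ binomSum q (suc a)
      binomSum-congruence {k} {a} pᵏ∣1+a =
        subst (ℤ.+ (p ℕ.^ suc k) ∣_) (ℤ.neg-involutive _)
              (∣m⇒∣-m (subst (ℤ.+ (p ℕ.^ suc k) ∣_) (W-coefficient a) Wₐ-divisible))
        where
        p∣A-1 : ℤ.+ p ∣ₛ A ⊕ ⊝ 𝟙
        p∣A-1 i = subst (ℤ.+ p ∣_) (sym (A-1≈E⊛Ĝ i)) (∣ₛ-⊛ Ĝ p∣E i)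
        Wₐ-divisible : ℤ.+ (p ℕ.^ suc k) ∣ W (suc a)
        Wₐ-divisible = logDerivative-divisible p-prime {k} pᵏ∣1+a A₀≡1 p∣A-1 logDerivative-A

open BinomialSumSeries using (binomSum-congruence)
open import Data.Nat using (ℕ; zero; suc; _^_; _≤_)
open import Data.Nat.Properties using (m≤n⇒∃[o]m+o≡n)
open import Data.Nat.Divisibility using (_∣_)
open import Data.Nat.Primality using (Prime)
open import Data.Integer as ℤ using (ℤ)
open import Data.Integer.Divisibility as ℤD using ()
open import Data.Integer.Divisibility.Signed using (∣⇒∣ᵤ)

theorem1p1 : (p q e k a : ℕ) → Prime p → 1 ≤ e → q ≡ p ^ e → p ^ k ∣ a → 1 ≤ a →
    (ℤ.+ (p ^ suc k)) ℤD.∣ (ℤ.+ 1 ℤ.+ (ℤ.+ q ℤ.- ℤ.+ 1) ℤ.* ℤ.+ (binomSum q a))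
theorem1p1 p q zero    k a       _       ()  _      _   _
theorem1p1 p q (suc e) k zero    _       _   _      _   ()
theorem1p1 p q (suc e) k (suc a) p-prime _ q≡pᵉ⁺¹ pᵏ∣a _ with m≤n⇒∃[o]m+o≡n (2≤p^[1+e] p-prime e)
-- After rewriting q to 2 + m′, the factor ℤ.+ q ℤ.- ℤ.+ 1 computes to ℤ.+ (1 + m′).
... | m′ , 2+m′≡pᵉ⁺¹ rewrite trans q≡pᵉ⁺¹ (sym 2+m′≡pᵉ⁺¹) =
  ∣⇒∣ᵤ (binomSum-congruence m′ {p} {e} p-prime 2+m′≡pᵉ⁺¹ {k} pᵏ∣a)
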